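{- For every odd integer $d\ge3$, the symplectic graph $Sp(2d,2)$ is not isomorphic to the block graph of any Steiner 2-design.
   Context: Let $V$ be a $2d$-dimensional vector space over the field of order $2$ with a non-degenerate symplectic bilinear form $\langle\cdot,\cdot\rangle$. $Sp(2d,2)$ is the graph whose vertices are the non-zero vectors of $V$, two distinct ones $x,y$ adjacent iff $\langle x,y\rangle\ne0$. A Steiner 2-design is a 2-design with $\lambda=1$ (any two distinct points in exactly one block); its block graph has the blocks as vertices, two blocks adjacent iff they share a point. -}

module Defs where

open import Data.Nat using (ℕ; _≤_)
open import Data.Bool using (Bool; true; false; _∧_; _∨_; _xor_; not; T)
open import Data.Product using (_×_; _,_; Σ; ∃; ∃-syntax)
open import Data.Fin using (Fin)
open import Data.Vec using (Vec; []; _∷_)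
import Data.Vec
open import Relation.Binary.PropositionalEquality using (_≡_)
open import Relation.Nullary using (¬_)
open import Function.Bundles using (_↔_; Inverse)

-- The 2d-dimensional space V = F₂^{2d}, written in coordinates adapted to a
-- symplectic basis e₁,f₁,…,e_d,f_d: a vector is a list of d pairs (aᵢ , bᵢ).
V : ℕ → Set
V d = Vec (Bool × Bool) d

form : ∀ {d} → V d → V d → Bool
form [] [] = false
form ((a , b) ∷ x) ((a' , b') ∷ y) = ((a ∧ b') xor (b ∧ a')) xor form x y

nonzero : ∀ {d} → V d → Bool
nonzero [] = false
nonzero ((a , b) ∷ x) = a ∨ b ∨ nonzero x

SpVertex : ℕ → Set
SpVertex d = Σ (V d) (λ x → T (nonzero x))

SpAdj : ∀ {d} → SpVertex d → SpVertex d → Set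
SpAdj (x , _) (y , _) = ¬ (x ≡ y) × T (form x y)

record Steiner2Design (v b k : ℕ) : Set where
  field
    incidence   : Fin b → Fin v → Bool

  incident : Fin b → Fin v → Set
  incident B p = T (incidence B p)

  field
    k≥2         : 2 ≤ k
    blockSize   : ∀ (B : Fin b) → Σ (Vec (Fin v) k) (λ ps →
                    (∀ (p : Fin v) → incident B p → Σ (Fin k) (λ i → Data.Vec.lookup ps i ≡ p))
                    × (∀ (i : Fin k) → incident B (Data.Vec.lookup ps i))
                    × (∀ (i j : Fin k) → Data.Vec.lookup ps i ≡ Data.Vec.lookup ps j → i ≡ j))
    uniqueBlock : ∀ (p q : Fin v) → ¬ (p ≡ q) →
                    Σ (Fin b) (λ B → incident B p × incident B q
                      × (∀ (B' : Fin b) → incident B' p → incident B' q → B' ≡ B))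

BlockAdj : ∀ {v b k} → Steiner2Design v b k → Fin b → Fin b → Set
BlockAdj {v} D B B' = ¬ (B ≡ B') × Σ (Fin v) (λ p → incident B p × incident B' p)
  where open Steiner2Design D

BlockGraph≅Sp : ∀ {v b k} → Steiner2Design v b k → ℕ → Set
BlockGraph≅Sp {b = b} D d =
  Σ (Fin b ↔ SpVertex d) (λ φ →
    ∀ (B B' : Fin b) →
      (BlockAdj D B B' → SpAdj (Inverse.to φ B) (Inverse.to φ B'))
      × (SpAdj (Inverse.to φ B) (Inverse.to φ B') → BlockAdj D B B'))

-- Suppose the blocks of a 2-(v,k,1) design are labelled by the non-zero vectors of
-- F₂^{2d} so that two blocks meet exactly when their labels are non-orthogonal.
-- Lower bound: the 2^{d-1} vectors f₁ + Σ_{i≥2} wᵢeᵢ are pairwise orthogonal and all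
-- non-orthogonal to e₁, so their blocks are pairwise disjoint and each meets the block
-- of e₁ in its own point; hence k ≥ 2^{d-1}.
-- Upper bound: the blocks of e₁, e₂ and e₁ + e₂ are pairwise disjoint and no block
-- meets all three, since ⟨z,e₁⟩ + ⟨z,e₂⟩ = ⟨z,e₁+e₂⟩. The lines joining a point q of
-- the first block to the 2k points of the other two are therefore distinct blocks
-- through q, i.e. 2k pairwise non-orthogonal vectors. An even family of pairwise
-- non-orthogonal vectors is linearly independent, so 2k ≤ 2d. Since d < 2^{d-1} for
-- d ≥ 3, the two bounds are incompatible.
module Submission where

open import Defs
open import Data.Nat using (ℕ; _≤_; _%_)
open import Relation.Binary.PropositionalEquality using (_≡_)
open import Relation.Nullary using (¬_)

open import Algebra.Bundles using (CommutativeRing)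
open import Data.Bool using (Bool; true; false; _∧_; _xor_; T; if_then_else_)
open import Data.Bool.Properties
  using (xor-∧-commutativeRing; xor-same; ∧-distribˡ-xor; ∧-zeroʳ; ∧-comm; ∧-identityʳ;
         not-involutive; ¬-not; T-≡; xor-identityʳ; xor-assoc)
  renaming (_≟_ to _≟ᵇ_)
open import Data.Empty using (⊥)
open import Data.Fin using (Fin; zero; suc; combine; splitAt; join; fromℕ<; funToFin; finToFun; _≟_)
open import Data.Fin.Properties
  using (2↔Bool; suc-injective; combine-injective; funToFin-finToFin; injective⇒≤; join-splitAt)
open import Data.Nat using (zero; suc; _+_; _^_; _<_; z≤n; s≤s)
open import Data.Nat.Properties
  using (^-*-assoc; ^-monoʳ-<; +-identityʳ; +-suc; +-comm; +-mono-≤; ≤-trans; <⇒≱; ≮⇒≥; m≤m+n; m^n>0)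
open import Data.Product using (Σ; _×_; _,_; proj₁; proj₂)
open import Data.Sum using (_⊎_; inj₁; inj₂)
open import Data.Unit using (tt)
open import Data.Vec using (_∷_; []; lookup; replicate; tabulate)
open import Data.Vec.Properties using (∷-injective; lookup∘tabulate)
open import Function using (_∘_; Injection; Inverse; Equivalence)
open import Function.Properties.Inverse using (↔⇒↣; ↔-sym)
open import Relation.Binary.PropositionalEquality
  using (_≢_; _≗_; refl; sym; trans; cong; cong₂; subst; subst₂; ≢-sym; module ≡-Reasoning)
open import Relation.Nullary using (contradiction)
open import Relation.Nullary.Decidable using (decidable-stable)

open CommutativeRing xor-∧-commutativeRing using (+-commutativeSemigroup)
open import Algebra.Properties.CommutativeSemigroup +-commutativeSemigroup
  using (xy∙z≈y∙zx) renaming (interchange to xor-interchange)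

xor≡false⇒≡ : ∀ {x y} → x xor y ≡ false → x ≡ y
xor≡false⇒≡ {false} {false} _ = refl
xor≡false⇒≡ {true}  {true}  _ = refl

xor-difference : ∀ a s b t → a xor s ≡ b xor t → a xor b ≡ s xor t
xor-difference a s b t eq = xor≡false⇒≡ (begin
  (a xor b) xor (s xor t)  ≡⟨ xor-interchange a b s t ⟩
  (a xor s) xor (b xor t)  ≡⟨ cong (_xor (b xor t)) eq ⟩
  (b xor t) xor (b xor t)  ≡⟨ xor-same (b xor t) ⟩
  false                    ∎)
  where open ≡-Reasoning

xorSum : ∀ {m} → (Fin m → Bool) → Bool
xorSum {zero}  f = false
xorSum {suc m} f = f zero xor xorSum (f ∘ suc)

xorSum-cong : ∀ {m} {f g : Fin m → Bool} → f ≗ g → xorSum f ≡ xorSum g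
xorSum-cong {zero}  f≗g = refl
xorSum-cong {suc m} f≗g = cong₂ _xor_ (f≗g zero) (xorSum-cong (f≗g ∘ suc))

xorSum-xor : ∀ {m} (f g : Fin m → Bool) → xorSum (λ i → f i xor g i) ≡ xorSum f xor xorSum g
xorSum-xor {zero}  f g = refl
xorSum-xor {suc m} f g = begin
  (f zero xor g zero) xor xorSum (λ i → f (suc i) xor g (suc i))
    ≡⟨ cong ((f zero xor g zero) xor_) (xorSum-xor (f ∘ suc) (g ∘ suc)) ⟩
  (f zero xor g zero) xor (xorSum (f ∘ suc) xor xorSum (g ∘ suc))
    ≡⟨ xor-interchange (f zero) (g zero) _ _ ⟩
  (f zero xor xorSum (f ∘ suc)) xor (g zero xor xorSum (g ∘ suc)) ∎
  where open ≡-Reasoning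

xorSum-except : ∀ {m} (f S : Fin m → Bool) (i : Fin m) →
                (∀ j → j ≢ i → f j ≡ S j) → f i ≡ false → xorSum f ≡ xorSum S xor S i
xorSum-except {suc m} f S zero f≡S fi≡false = begin
  f zero xor xorSum (f ∘ suc)                  ≡⟨ cong₂ _xor_ fi≡false (xorSum-cong (λ j → f≡S (suc j) λ ())) ⟩
  xorSum (S ∘ suc)                             ≡⟨ xor-identityʳ _ ⟨
  xorSum (S ∘ suc) xor false                   ≡⟨ cong (xorSum (S ∘ suc) xor_) (xor-same (S zero)) ⟨
  xorSum (S ∘ suc) xor (S zero xor S zero)     ≡⟨ xy∙z≈y∙zx (S zero) (xorSum (S ∘ suc)) (S zero) ⟨
  (S zero xor xorSum (S ∘ suc)) xor S zero     ∎
  where open ≡-Reasoning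
xorSum-except {suc m} f S (suc i) f≡S fi≡false = begin
  f zero xor xorSum (f ∘ suc)
    ≡⟨ cong₂ _xor_ (f≡S zero λ ())
         (xorSum-except (f ∘ suc) (S ∘ suc) i (λ j j≢i → f≡S (suc j) (j≢i ∘ suc-injective)) fi≡false) ⟩
  S zero xor (xorSum (S ∘ suc) xor S (suc i))  ≡⟨ xor-assoc (S zero) (xorSum (S ∘ suc)) (S (suc i)) ⟨
  (S zero xor xorSum (S ∘ suc)) xor S (suc i)  ∎
  where open ≡-Reasoning

xorSum-true-even : ∀ k → xorSum (λ (_ : Fin (k + k)) → true) ≡ false
xorSum-true-even zero = refl
xorSum-true-even (suc k) rewrite +-suc k k = trans (not-involutive _) (xorSum-true-even k)

0ᵥ : ∀ {n} → V n
0ᵥ {n} = replicate n (false , false)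

infixl 6 _+ᵥ_
_+ᵥ_ : ∀ {n} → V n → V n → V n
[] +ᵥ [] = []
((a , b) ∷ x) +ᵥ ((a' , b') ∷ y) = (a xor a' , b xor b') ∷ (x +ᵥ y)

form-0ˡ : ∀ {n} (x : V n) → form 0ᵥ x ≡ false
form-0ˡ []      = refl
form-0ˡ (_ ∷ x) = form-0ˡ x

form-0ʳ : ∀ {n} (x : V n) → form x 0ᵥ ≡ false
form-0ʳ []            = refl
form-0ʳ ((a , b) ∷ x) rewrite ∧-zeroʳ a | ∧-zeroʳ b = form-0ʳ x

form-alternating : ∀ {n} (x : V n) → form x x ≡ false
form-alternating []            = refl
form-alternating ((a , b) ∷ x) rewrite ∧-comm a b | xor-same (b ∧ a) = form-alternating x

form-+ʳ : ∀ {n} (z x y : V n) → form z (x +ᵥ y) ≡ form z x xor form z y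
form-+ʳ [] [] [] = refl
form-+ʳ ((a , b) ∷ z) ((a' , b') ∷ x) ((a'' , b'') ∷ y) = begin
  ((a ∧ (b' xor b'')) xor (b ∧ (a' xor a''))) xor form z (x +ᵥ y)
    ≡⟨ cong₂ _xor_ (cong₂ _xor_ (∧-distribˡ-xor a b' b'') (∧-distribˡ-xor b a' a'')) (form-+ʳ z x y) ⟩
  (((a ∧ b') xor (a ∧ b'')) xor ((b ∧ a') xor (b ∧ a''))) xor (form z x xor form z y)
    ≡⟨ cong (_xor (form z x xor form z y)) (xor-interchange (a ∧ b') (a ∧ b'') (b ∧ a') (b ∧ a'')) ⟩
  (((a ∧ b') xor (b ∧ a')) xor ((a ∧ b'') xor (b ∧ a''))) xor (form z x xor form z y)
    ≡⟨ xor-interchange ((a ∧ b') xor (b ∧ a')) ((a ∧ b'') xor (b ∧ a'')) (form z x) (form z y) ⟩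
  (((a ∧ b') xor (b ∧ a')) xor form z x) xor (((a ∧ b'') xor (b ∧ a'')) xor form z y) ∎
  where open ≡-Reasoning

spanₑ : ∀ {n} → (Fin n → Bool) → V n
spanₑ w = tabulate λ i → (w i , false)

form-spanₑ : ∀ {n} (w w' : Fin n → Bool) → form (spanₑ w) (spanₑ w') ≡ false
form-spanₑ {zero}  w w' = refl
form-spanₑ {suc n} w w' rewrite ∧-zeroʳ (w zero) = form-spanₑ (w ∘ suc) (w' ∘ suc)

spanₑ-injective : ∀ {n} {w w' : Fin n → Bool} → spanₑ w ≡ spanₑ w' → w ≗ w'
spanₑ-injective {w = w} {w'} eq i = cong proj₁ (begin
  (w i , false)              ≡⟨ lookup∘tabulate _ i ⟨
  lookup (spanₑ w) i         ≡⟨ cong (λ x → lookup x i) eq ⟩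
  lookup (spanₑ w') i        ≡⟨ lookup∘tabulate _ i ⟩
  (w' i , false)             ∎)
  where open ≡-Reasoning

-- Even cliques of Sp(2n,2) are linearly independent

IsClique : ∀ {m n} → (Fin m → V n) → Set
IsClique g = ∀ i j → i ≢ j → form (g i) (g j) ≡ true

subsetSum : ∀ {m n} → (Fin m → V n) → (Fin m → Bool) → V n
subsetSum {zero}  g S = 0ᵥ
subsetSum {suc m} g S = (if S zero then g zero else 0ᵥ) +ᵥ subsetSum (g ∘ suc) (S ∘ suc)

form-subsetSum : ∀ {m n} (z : V n) (g : Fin m → V n) (S : Fin m → Bool) →
                 form z (subsetSum g S) ≡ xorSum (λ i → S i ∧ form z (g i))
form-subsetSum {zero}  z g S = form-0ʳ z
form-subsetSum {suc m} z g S =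
  trans (form-+ʳ z _ _) (cong₂ _xor_ (form-if (S zero)) (form-subsetSum z (g ∘ suc) (S ∘ suc)))
  where
  form-if : ∀ s → form z (if s then g zero else 0ᵥ) ≡ s ∧ form z (g zero)
  form-if true  = refl
  form-if false = form-0ʳ z

form-clique-subsetSum : ∀ {m n} {g : Fin m → V n} → IsClique g → ∀ S i →
                        form (g i) (subsetSum g S) ≡ xorSum S xor S i
form-clique-subsetSum {g = g} clique S i =
  trans (form-subsetSum (g i) g S) (xorSum-except _ S i off-diagonal diagonal)
  where
  off-diagonal : ∀ j → j ≢ i → S j ∧ form (g i) (g j) ≡ S j
  off-diagonal j j≢i = trans (cong (S j ∧_) (clique i j (≢-sym j≢i))) (∧-identityʳ (S j))
  diagonal : S i ∧ form (g i) (g i) ≡ false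
  diagonal = trans (cong (S i ∧_) (form-alternating (g i))) (∧-zeroʳ (S i))

-- Pairing with each gᵢ shows that Sᵢ xor Rᵢ is the same c for all i; if c were true,
-- then c = xorSum S xor xorSum R would be the parity of k + k ones.
subsetSum-injective : ∀ {k n} {g : Fin (k + k) → V n} → IsClique g →
                      ∀ {S R} → subsetSum g S ≡ subsetSum g R → S ≗ R
subsetSum-injective {k} {g = g} clique {S} {R} eq i = xor≡false⇒≡ (trans (sym (difference i)) c≡false)
  where
  c : Bool
  c = xorSum S xor xorSum R

  difference : ∀ i → c ≡ S i xor R i
  difference i = xor-difference (xorSum S) (S i) (xorSum R) (R i) (begin
    xorSum S xor S i            ≡⟨ form-clique-subsetSum {g = g} clique S i ⟨
    form (g i) (subsetSum g S)  ≡⟨ cong (form (g i)) eq ⟩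
    form (g i) (subsetSum g R)  ≡⟨ form-clique-subsetSum {g = g} clique R i ⟩
    xorSum R xor R i            ∎)
    where open ≡-Reasoning

  c≡false : c ≡ false
  c≡false = ¬-not λ c≡true → contradiction (begin
    true                                ≡⟨ c≡true ⟨
    xorSum S xor xorSum R               ≡⟨ xorSum-xor S R ⟨
    xorSum (λ i → S i xor R i)          ≡⟨ xorSum-cong (λ i → trans (sym (difference i)) c≡true) ⟩
    xorSum (λ (_ : Fin (k + k)) → true) ≡⟨ xorSum-true-even k ⟩
    false                               ∎) λ ()
    where open ≡-Reasoning

funToFin-cong : ∀ {m n} {f g : Fin m → Fin n} → f ≗ g → funToFin f ≡ funToFin g
funToFin-cong {zero}  f≗g = refl
funToFin-cong {suc m} f≗g = cong₂ combine (f≗g zero) (funToFin-cong (f≗g ∘ suc))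

subset-injection⇒2^≤ : ∀ {m K} (h : (Fin m → Bool) → Fin K) →
                       (∀ {S R} → h S ≡ h R → S ≗ R) → 2 ^ m ≤ K
subset-injection⇒2^≤ {m} h h-injective = injective⇒≤ {f = h ∘ asSubset} λ {i} {j} hi≡hj → begin
  i                               ≡⟨ funToFin-finToFin {m} i ⟨
  funToFin (finToFun {2} {m} i)   ≡⟨ funToFin-cong (λ x → toBool-injective (h-injective hi≡hj x)) ⟩
  funToFin (finToFun {2} {m} j)   ≡⟨ funToFin-finToFin {m} j ⟩
  j                               ∎
  where
  open ≡-Reasoning
  toBool-injective : ∀ {x y} → Inverse.to 2↔Bool x ≡ Inverse.to 2↔Bool y → x ≡ y
  toBool-injective = Injection.injective (↔⇒↣ 2↔Bool)
  asSubset : Fin (2 ^ m) → Fin m → Bool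
  asSubset i = Inverse.to 2↔Bool ∘ finToFun i

encodeᵥ : ∀ {n} → V n → Fin (4 ^ n)
encodeᵥ []            = zero
encodeᵥ ((a , b) ∷ x) = combine (combine (fromBool a) (fromBool b)) (encodeᵥ x)
  where fromBool = Inverse.from 2↔Bool

encodeᵥ-injective : ∀ {n} {x y : V n} → encodeᵥ x ≡ encodeᵥ y → x ≡ y
encodeᵥ-injective {x = []}            {[]}             _  = refl
encodeᵥ-injective {x = (a , b) ∷ x} {(a' , b') ∷ y} eq
  with ab≡a'b' , x≡y ← combine-injective _ (encodeᵥ x) _ (encodeᵥ y) eq
  with a≡a' , b≡b' ← combine-injective _ _ _ _ ab≡a'b' =
  cong₂ _∷_ (cong₂ _,_ (fromBool-injective a≡a') (fromBool-injective b≡b')) (encodeᵥ-injective x≡y)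
  where
  fromBool-injective : ∀ {x y} → Inverse.from 2↔Bool x ≡ Inverse.from 2↔Bool y → x ≡ y
  fromBool-injective = Injection.injective (↔⇒↣ (↔-sym 2↔Bool))

4^n≡2^[n+n] : ∀ n → 4 ^ n ≡ 2 ^ (n + n)
4^n≡2^[n+n] n = trans (^-*-assoc 2 2 n) (cong (λ m → 2 ^ (n + m)) (+-identityʳ n))

evenClique-≤ : ∀ {m n} (g : Fin (m + m) → V n) → IsClique g → m ≤ n
evenClique-≤ {m} {n} g clique = ≮⇒≥ λ n<m →
  <⇒≱ (subst (4 ^ n <_) (4^n≡2^[n+n] m) (^-monoʳ-< 4 (s≤s (s≤s z≤n)) n<m)) subsets≤V
  where
  subsets≤V : 2 ^ (m + m) ≤ 4 ^ n
  subsets≤V = subset-injection⇒2^≤ (encodeᵥ ∘ subsetSum g)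
                (subsetSum-injective {m} {g = g} clique ∘ encodeᵥ-injective)

3+n<2^[2+n] : ∀ n → 3 + n < 2 ^ (2 + n)
3+n<2^[2+n] zero    = s≤s (s≤s (s≤s (s≤s z≤n)))
3+n<2^[2+n] (suc n) = subst (_≤ 2 ^ (3 + n)) (+-comm (4 + n) 1)
  (+-mono-≤ (3+n<2^[2+n] n) (≤-trans (m^n>0 2 (2 + n)) (m≤m+n _ 0)))

module SteinerFacts {v b k} (D : Steiner2Design v b k) where
  open Steiner2Design D

  Disjoint : Fin b → Fin b → Set
  Disjoint B B' = ∀ {p} → incident B p → incident B' p → ⊥

  point : Fin b → Fin k → Fin v
  point B = lookup (proj₁ (blockSize B))

  point-incident : ∀ B i → incident B (point B i)
  point-incident B = proj₁ (proj₂ (proj₂ (blockSize B)))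

  point-injective : ∀ B {i j} → point B i ≡ point B j → i ≡ j
  point-injective B = proj₂ (proj₂ (proj₂ (blockSize B))) _ _

  pointIndex : ∀ B {p} → incident B p → Fin k
  pointIndex B p∈B = proj₁ (proj₁ (proj₂ (blockSize B)) _ p∈B)

  point-pointIndex : ∀ B {p} (p∈B : incident B p) → point B (pointIndex B p∈B) ≡ p
  point-pointIndex B p∈B = proj₂ (proj₁ (proj₂ (blockSize B)) _ p∈B)

  line : ∀ p q → p ≢ q → Fin b
  line p q p≢q = proj₁ (uniqueBlock p q p≢q)

  line-∋ˡ : ∀ {p q} (p≢q : p ≢ q) → incident (line p q p≢q) p
  line-∋ˡ p≢q = proj₁ (proj₂ (uniqueBlock _ _ p≢q))

  line-∋ʳ : ∀ {p q} (p≢q : p ≢ q) → incident (line p q p≢q) q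
  line-∋ʳ p≢q = proj₁ (proj₂ (proj₂ (uniqueBlock _ _ p≢q)))

  two-points-determine-block : ∀ {p q B B'} → p ≢ q → incident B p → incident B q →
                               incident B' p → incident B' q → B ≡ B'
  two-points-determine-block p≢q p∈B q∈B p∈B' q∈B' =
    trans (unique _ p∈B q∈B) (sym (unique _ p∈B' q∈B'))
    where unique = proj₂ (proj₂ (proj₂ (uniqueBlock _ _ p≢q)))

  lineTo : ∀ {q} B → ¬ incident B q → Fin k → Fin b
  lineTo B q∉B i = line _ (point B i) λ q≡pᵢ → q∉B (subst (incident B) (sym q≡pᵢ) (point-incident B i))

  lineTo-∋ : ∀ {q} B (q∉B : ¬ incident B q) i → incident (lineTo B q∉B i) q
  lineTo-∋ B q∉B i = line-∋ˡ _

  lineTo-∋-point : ∀ {q} B (q∉B : ¬ incident B q) i → incident (lineTo B q∉B i) (point B i)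
  lineTo-∋-point B q∉B i = line-∋ʳ _

  lineTo-injective : ∀ {q} B (q∉B : ¬ incident B q) {i j} → lineTo B q∉B i ≡ lineTo B q∉B j → i ≡ j
  lineTo-injective B q∉B {i} {j} eq = decidable-stable (i ≟ j) λ i≢j →
    q∉B (subst (λ L → incident L _) (line≡B i≢j) (lineTo-∋ B q∉B i))
    where
    line≡B : i ≢ j → lineTo B q∉B i ≡ B
    line≡B i≢j = two-points-determine-block (i≢j ∘ point-injective B)
               (lineTo-∋-point B q∉B i) (subst (λ L → incident L (point B j)) (sym eq) (lineTo-∋-point B q∉B j))
               (point-incident B i) (point-incident B j)

-- A design whose block graph is Sp(2d,2), d = n + 2

module SymplecticBlockGraph {v b k} (D : Steiner2Design v b k) (n : ℕ)
                            (iso : BlockGraph≅Sp D (suc (suc n))) where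
  open Steiner2Design D
  open SteinerFacts D

  d : ℕ
  d = suc (suc n)

  vec : Fin b → V d
  vec B = proj₁ (Inverse.to (proj₁ iso) B)

  block : (x : V d) → T (nonzero x) → Fin b
  block x x≢0 = Inverse.from (proj₁ iso) (x , x≢0)

  vec-block : ∀ x x≢0 → vec (block x x≢0) ≡ x
  vec-block x x≢0 = cong proj₁ (Inverse.strictlyInverseˡ (proj₁ iso) (x , x≢0))

  meet⇒nonorthogonal : ∀ {B B' p} → B ≢ B' → incident B p → incident B' p →
                       form (vec B) (vec B') ≡ true
  meet⇒nonorthogonal B≢B' p∈B p∈B' = Equivalence.to T-≡ (proj₂ (proj₁ (proj₂ iso _ _) (B≢B' , _ , p∈B , p∈B')))

  nonorthogonal⇒meet : ∀ {x y} x≢0 y≢0 → x ≢ y → T (form x y) →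
                       Σ (Fin v) λ p → incident (block x x≢0) p × incident (block y y≢0) p
  nonorthogonal⇒meet {x} {y} x≢0 y≢0 x≢y xy = proj₂ (proj₂ (proj₂ iso _ _)
    (subst₂ (λ x' y' → x' ≢ y' × T (form x' y')) (sym (vec-block x x≢0)) (sym (vec-block y y≢0)) (x≢y , xy)))

  orthogonal⇒disjoint : ∀ {x y} x≢0 y≢0 → x ≢ y → form x y ≡ false →
                        Disjoint (block x x≢0) (block y y≢0)
  orthogonal⇒disjoint {x} {y} x≢0 y≢0 x≢y x⊥y p∈X p∈Y = contradiction (begin
    true                  ≡⟨ meet⇒nonorthogonal X≢Y p∈X p∈Y ⟨
    form (vec X) (vec Y)  ≡⟨ cong₂ form (vec-block x x≢0) (vec-block y y≢0) ⟩
    form x y              ≡⟨ x⊥y ⟩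
    false                 ∎) λ ()
    where
    open ≡-Reasoning
    X = block x x≢0
    Y = block y y≢0
    X≢Y : X ≢ Y
    X≢Y X≡Y = x≢y (trans (sym (vec-block x x≢0)) (trans (cong vec X≡Y) (vec-block y y≢0)))

  e₁ e₂ : V d
  e₁ = (true , false) ∷ 0ᵥ
  e₂ = (false , false) ∷ (true , false) ∷ 0ᵥ

  B₁ : Fin b
  B₁ = block e₁ tt

  f₁+spanₑ : (Fin (suc n) → Bool) → V d
  f₁+spanₑ w = (false , true) ∷ spanₑ w

  2^≤k : 2 ^ suc n ≤ k
  2^≤k = subset-injection⇒2^≤ index index-injective
    where
    Z : (Fin (suc n) → Bool) → Fin b
    Z w = block (f₁+spanₑ w) tt

    meeting : ∀ w → Σ (Fin v) λ p → incident B₁ p × incident (Z w) p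
    meeting w = nonorthogonal⇒meet tt tt (λ ()) (subst (λ c → T (true xor c)) (sym (form-0ˡ (spanₑ w))) tt)

    index : (Fin (suc n) → Bool) → Fin k
    index w = pointIndex B₁ (proj₁ (proj₂ (meeting w)))

    index-injective : ∀ {w w'} → index w ≡ index w' → w ≗ w'
    index-injective {w} {w'} eq i = decidable-stable (w i ≟ᵇ w' i) λ wᵢ≢w'ᵢ →
      orthogonal⇒disjoint tt tt (λ e → wᵢ≢w'ᵢ (spanₑ-injective {w = w} {w'} (proj₂ (∷-injective e)) i)) (form-spanₑ w w')
        (proj₂ (proj₂ (meeting w))) (subst (incident (Z w')) (sym same-point) (proj₂ (proj₂ (meeting w'))))
      where
      same-point : proj₁ (meeting w) ≡ proj₁ (meeting w')
      same-point = trans (sym (point-pointIndex B₁ _)) (trans (cong (point B₁) eq) (point-pointIndex B₁ _))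

  B₂ B₃ : Fin b
  B₂ = block e₂ tt
  B₃ = block (e₁ +ᵥ e₂) tt

  B₁∩B₂=∅ : Disjoint B₁ B₂
  B₁∩B₂=∅ = orthogonal⇒disjoint tt tt (λ ()) (form-0ˡ (0ᵥ {n}))

  B₁∩B₃=∅ : Disjoint B₁ B₃
  B₁∩B₃=∅ = orthogonal⇒disjoint tt tt (λ ()) (form-0ˡ (0ᵥ {n} +ᵥ 0ᵥ))

  no-block-meets-all : ∀ Z {p q r} → incident Z p → incident B₁ p → incident Z q → incident B₂ q →
                       incident Z r → incident B₃ r → ⊥
  no-block-meets-all Z p∈Z p∈B₁ q∈Z q∈B₂ r∈Z r∈B₃ = contradiction (begin
    true                                      ≡⟨ form-Z≡true Z≢B₃ r∈Z r∈B₃ ⟨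
    form (vec Z) (e₁ +ᵥ e₂)                   ≡⟨ form-+ʳ (vec Z) e₁ e₂ ⟩
    form (vec Z) e₁ xor form (vec Z) e₂       ≡⟨ cong₂ _xor_ (form-Z≡true Z≢B₁ p∈Z p∈B₁) (form-Z≡true Z≢B₂ q∈Z q∈B₂) ⟩
    false                                     ∎) λ ()
    where
    open ≡-Reasoning
    form-Z≡true : ∀ {x x≢0 p} → Z ≢ block x x≢0 → incident Z p → incident (block x x≢0) p → form (vec Z) x ≡ true
    form-Z≡true {x} {x≢0} Z≢X p∈Z p∈X = trans (cong (form (vec Z)) (sym (vec-block x x≢0))) (meet⇒nonorthogonal Z≢X p∈Z p∈X)
    Z≢B₁ : Z ≢ block e₁ tt
    Z≢B₁ Z≡B₁ = B₁∩B₂=∅ (subst (λ B → incident B _) Z≡B₁ q∈Z) q∈B₂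
    Z≢B₂ : Z ≢ block e₂ tt
    Z≢B₂ Z≡B₂ = B₁∩B₂=∅ p∈B₁ (subst (λ B → incident B _) Z≡B₂ p∈Z)
    Z≢B₃ : Z ≢ block (e₁ +ᵥ e₂) tt
    Z≢B₃ Z≡B₃ = B₁∩B₃=∅ p∈B₁ (subst (λ B → incident B _) Z≡B₃ p∈Z)

  q : Fin v
  q = point B₁ (fromℕ< (≤-trans (s≤s z≤n) k≥2))

  q∈B₁ : incident B₁ q
  q∈B₁ = point-incident B₁ _

  q∉B₂ : ¬ incident B₂ q
  q∉B₂ = B₁∩B₂=∅ q∈B₁

  q∉B₃ : ¬ incident B₃ q
  q∉B₃ = B₁∩B₃=∅ q∈B₁

  lines : Fin k ⊎ Fin k → Fin b
  lines (inj₁ i) = lineTo B₂ q∉B₂ i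
  lines (inj₂ i) = lineTo B₃ q∉B₃ i

  q∈lines : ∀ j → incident (lines j) q
  q∈lines (inj₁ i) = lineTo-∋ B₂ q∉B₂ i
  q∈lines (inj₂ i) = lineTo-∋ B₃ q∉B₃ i

  lines-B₂≢lines-B₃ : ∀ i i' → lines (inj₁ i) ≢ lines (inj₂ i')
  lines-B₂≢lines-B₃ i i' eq = no-block-meets-all (lines (inj₁ i)) (q∈lines (inj₁ i)) q∈B₁
    (lineTo-∋-point B₂ q∉B₂ i) (point-incident B₂ i)
    (subst (λ L → incident L (point B₃ i')) (sym eq) (lineTo-∋-point B₃ q∉B₃ i')) (point-incident B₃ i')

  lines-injective : ∀ {j j'} → lines j ≡ lines j' → j ≡ j'
  lines-injective {inj₁ i} {inj₁ i'} eq = cong inj₁ (lineTo-injective B₂ q∉B₂ eq)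
  lines-injective {inj₂ i} {inj₂ i'} eq = cong inj₂ (lineTo-injective B₃ q∉B₃ eq)
  lines-injective {inj₁ i} {inj₂ i'} eq = contradiction eq (lines-B₂≢lines-B₃ i i')
  lines-injective {inj₂ i} {inj₁ i'} eq = contradiction (sym eq) (lines-B₂≢lines-B₃ i' i)

  lines-clique : IsClique (vec ∘ lines ∘ splitAt k)
  lines-clique i j i≢j = meet⇒nonorthogonal (i≢j ∘ splitAt-injective ∘ lines-injective)
                       (q∈lines (splitAt k i)) (q∈lines (splitAt k j))
    where
    splitAt-injective : splitAt k i ≡ splitAt k j → i ≡ j
    splitAt-injective eq = trans (sym (join-splitAt k k i)) (trans (cong (join k k) eq) (join-splitAt k k j))

  k≤d : k ≤ d
  k≤d = evenClique-≤ (vec ∘ lines ∘ splitAt k) lines-clique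

corollary4p8 : ∀ (d : ℕ) → 3 ≤ d → d % 2 ≡ 1 →
    ∀ (v b k : ℕ) (D : Steiner2Design v b k) → ¬ BlockGraph≅Sp D d
corollary4p8 (suc (suc (suc n))) (s≤s (s≤s (s≤s _))) _ v b k D iso =
  <⇒≱ (3+n<2^[2+n] n) (≤-trans 2^≤k k≤d)
  where open SymplecticBlockGraph D (suc n) iso
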